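{- Let $\mathbf m=(m_1,\dots,m_n)$ be positive integers. Let $V(\mathbf m)$ be the set of integer vectors $\langle x_{1_1},\dots,x_{1_{m_1}},\dots,x_{n_1},\dots,x_{n_{m_n}}\rangle$ such that for all $i,j$, $0=x_{i_1}\le x_{i_j}\le x_{i_{j+1}}\le\sum_{k=i+1}^n m_k$, ordered by the reflexive-transitive closure of: $v\lessdot v'$ iff $v,v'$ differ in exactly one entry, which is one larger in $v'$. Then the rank-generating function of $V(\mathbf m)$, and also that of $\mathbf{BL}(\mathbf m)$, is \[\prod_{i=1}^{n}\begin{bmatrix}(\sum_{j=i}^n m_j)-1\\ m_i-1\end{bmatrix}_q,\qquad\text{where }\begin{bmatrix}a\\ b\end{bmatrix}_q=\frac{[a]_q!}{[a-b]_q!\,[b]_q!}.\]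
   Context: $\mathbf{BL}(\mathbf m)$ is the set of words of the multiset with $m_i$ copies of $i$ ($i\in[n]$) in which, for each $i\in[n-1]$, the first occurrence of $i$ precedes the first occurrence of $i+1$, partially ordered by the reflexive-transitive closure of: $s\lessdot t$ iff $t$ arises from $s$ by swapping two adjacent entries $a<b$ appearing as $ab$ in $s$. It is graded with minimum $1^{m_1}2^{m_2}\cdots n^{m_n}$; the rank of $s$ equals its number of inversions (pairs of positions $p<p'$ with $s_p>s_{p'}$). The rank of $v\in V(\mathbf m)$ is the sum of its entries. The rank-generating function of a graded poset $P$ is $\sum_{x\in P}q^{\mathrm{rk}(x)}$. Here $[a]_q!=\prod_{k=1}^a(1+q+\dots+q^{k-1})$. -}

module Defs where

open import Data.Nat using (ℕ; zero; suc; _+_; _*_; _∸_; _≤_; _<_; _≡ᵇ_; _<?_; _≟_)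
open import Data.Nat.ListAction using (sum)
open import Data.List using (List; []; _∷_; length; map; filter; replicate; foldr; applyUpTo; zip; head)
open import Data.List.Relation.Unary.All using (All)
open import Data.List.Relation.Unary.Linked using (Linked)
open import Data.Maybe using (Maybe; just)
open import Data.Bool using (if_then_else_)
open import Data.Product using (Σ; _×_; _,_; proj₁; proj₂)
open import Data.Fin using (Fin)
open import Function.Bundles using (_↔_)
open import Relation.Binary.PropositionalEquality using (_≡_)

-- Polynomials in q with natural coefficients, as coefficient lists
-- (constant term first).  Equality is coefficientwise (so trailing
-- zeros do not matter).

Poly : Set
Poly = List ℕ

coeff : Poly → ℕ → ℕ
coeff []      _       = 0
coeff (a ∷ p) zero    = a
coeff (a ∷ p) (suc k) = coeff p k

infixl 6 _+P_
infixl 7 _*P_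
infix 4 _≈P_

_+P_ : Poly → Poly → Poly
[]      +P q       = q
(a ∷ p) +P []      = a ∷ p
(a ∷ p) +P (b ∷ q) = (a + b) ∷ (p +P q)

_*P_ : Poly → Poly → Poly
[]      *P q = []
(a ∷ p) *P q = map (a *_) q +P (0 ∷ (p *P q))

_≈P_ : Poly → Poly → Set
p ≈P q = ∀ k → coeff p k ≡ coeff q k

prodP : List Poly → Poly
prodP = foldr _*P_ (1 ∷ [])

qInt : ℕ → Poly
qInt a = replicate a 1

qFact : ℕ → Poly
qFact zero    = 1 ∷ []
qFact (suc a) = qFact a *P qInt (suc a)

-- The q-binomial [a over b]_q = [a]_q! / ([a-b]_q! [b]_q!) is recorded
-- by its numerator and denominator.
qBinomNum : ℕ × ℕ → Poly
qBinomNum (a , b) = qFact a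

qBinomDen : ℕ × ℕ → Poly
qBinomDen (a , b) = qFact (a ∸ b) *P qFact b

binomParams : List ℕ → List (ℕ × ℕ)
binomParams []       = []
binomParams (mi ∷ ms) = (sum (mi ∷ ms) ∸ 1 , mi ∸ 1) ∷ binomParams ms

IsRankGenFun : (P : Set) → (P → ℕ) → Poly → Set
IsRankGenFun P rk F = ∀ k → Fin (coeff F k) ↔ Σ P (λ x → rk x ≡ k)

-- A vector < x_{1_1},...,x_{1_{m_1}}, ..., x_{n_1},...,x_{n_{m_n}} >
-- is stored as the list of its blocks [x_{i_1},...,x_{i_{m_i}}] (i = 1..n).
-- Entries are naturals (they are integers ≥ 0 by the condition 0 = x_{i_1} ≤ ...).

Block : ℕ → ℕ → List ℕ → Set
Block mi bound x =
  (length x ≡ mi) × (head x ≡ just 0) × Linked _≤_ x × All (_≤ bound) x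

data IsV : List ℕ → List (List ℕ) → Set where
  []  : IsV [] []
  _∷_ : ∀ {mi ms x xs} → Block mi (sum ms) x → IsV ms xs → IsV (mi ∷ ms) (x ∷ xs)

V : List ℕ → Set
V m = Σ (List (List ℕ)) (IsV m)

rankV : ∀ {m} → V m → ℕ
rankV (xs , _) = sum (map sum xs)

occ : ℕ → List ℕ → ℕ
occ i w = length (filter (i ≟_) w)

-- position (0-based) of the first occurrence of i in w (length w if absent)
firstPos : ℕ → List ℕ → ℕ
firstPos i []      = 0
firstPos i (b ∷ w) = if i ≡ᵇ b then 0 else suc (firstPos i w)

IsBL : List ℕ → List ℕ → Set
IsBL m w =
  All (λ a → 1 ≤ a × a ≤ length m) w
  × All (λ p → occ (proj₁ p) w ≡ proj₂ p) (zip (applyUpTo suc (length m)) m)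
  × All (λ i → firstPos i w < firstPos (suc i) w) (applyUpTo suc (length m ∸ 1))

BL : List ℕ → Set
BL m = Σ (List ℕ) (IsBL m)

inversions : List ℕ → ℕ
inversions []      = 0
inversions (a ∷ w) = length (filter (_<? a) w) + inversions w

rankBL : ∀ {m} → BL m → ℕ
rankBL (w , _) = inversions w

-- Both posets are in rank-preserving bijection with the product over i of the weakly
-- increasing sequences of length m_i - 1 with entries in [0, m_{i+1} + ... + m_n], ranked
-- by their sum; such sequences satisfy the q-Pascal recurrence (start with 0, or subtract 1
-- from every entry), so they are counted by the q-binomial of the theorem, and Gauss's
-- identity [r+g over r]_q [g]_q! [r]_q! = [r+g]_q! gives the stated quotient.
-- For V(m) the i-th block is such a sequence preceded by 0.  A word of BL(m) starts with its
-- smallest letter 1; recording for each occurrence of 1 how many other letters precede it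
-- gives a block of V(m), these counts add up to the inversions involving 1, and erasing 1
-- leaves a word of BL(m_2, ..., m_n) with letters raised by one.

module Submission where

open import Defs
open import Algebra.Bundles using (CommutativeSemigroup)
import Algebra.Properties.CommutativeSemigroup as CommSemigroupProperties
open import Axiom.UniquenessOfIdentityProofs using (module Decidable⇒UIP)
open import Data.Bool using (true; false)
open import Data.Fin using (Fin; zero)
open import Data.Fin.Properties using (+↔⊎; *↔×)
open import Data.List using (List; []; _∷_; map; length; filter; zip; applyUpTo; head)
open import Data.List.Properties using (length-map; map-∘; map-id; map-id-local; filter-accept; filter-reject; filter-none)
open import Data.List.Relation.Unary.All as All using (All; []; _∷_)
import Data.List.Relation.Unary.All.Properties as All
open import Data.List.Relation.Unary.Linked as Linked using (Linked; []; [-]; _∷_)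
import Data.List.Relation.Unary.Linked.Properties as Linked
open import Data.List.Relation.Unary.Linked.Properties using (Linked⇒All)
open import Data.Maybe using (just)
import Data.Maybe.Properties as Maybe
open import Data.Nat using (ℕ; zero; suc; pred; _+_; _*_; _∸_; _≤_; _<_; z≤n; s≤s; s≤s⁻¹; z<s; s<s; _<?_; _≟_; _≡ᵇ_)
open import Data.Nat.ListAction using (sum)
open import Data.Nat.Properties
open import Data.Nat.Tactic.RingSolver using (solve-∀)
open import Data.Product using (Σ; _×_; _,_; proj₁; proj₂)
open import Data.Product.Function.Dependent.Propositional using (Σ-↔)
open import Data.Product.Function.NonDependent.Propositional using (_×-↔_; _×-⇔_)
open import Data.Sum using (_⊎_; inj₁; inj₂; [_,_]′)
open import Data.Sum.Function.Propositional using (_⊎-↔_; _⊎-⇔_)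
open import Data.Unit using (⊤; tt)
open import Function.Base using (_∘_)
open import Function.Bundles using (_↔_; mk↔ₛ′; Inverse; _⇔_; mk⇔; Equivalence)
open import Function.Construct.Composition using (_↔-∘_; _⇔-∘_)
open import Function.Construct.Identity using (⇔-id)
open import Function.Construct.Symmetry using (↔-sym; ⇔-sym)
open import Function.Properties.Inverse using (↔-refl)
open import Function.Related.TypeIsomorphisms using (Σ-distribʳ-⊎)
open import Level using (0ℓ)
open import Relation.Binary.Bundles using (Setoid)
open import Relation.Binary.Structures using (IsEquivalence)
open import Relation.Binary.PropositionalEquality
import Relation.Binary.Reasoning.Setoid as SetoidReasoning
open import Relation.Nullary using (yes; no; contradiction)
import Relation.Unary as U

module ℕ+ = CommSemigroupProperties +-commutativeSemigroup

-- Polynomials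

infix 4 _≈_

-- _≈P_ wrapped in a record, so that its two sides can be inferred from a proof.
record _≈_ (p q : Poly) : Set where
  constructor mk≈
  field coeff-≡ : p ≈P q
open _≈_ public

≈-isEquivalence : IsEquivalence _≈_
≈-isEquivalence = record
  { refl  = mk≈ λ _ → refl
  ; sym   = λ e → mk≈ λ k → sym (coeff-≡ e k)
  ; trans = λ e f → mk≈ λ k → trans (coeff-≡ e k) (coeff-≡ f k)
  }

≈-setoid : Setoid 0ℓ 0ℓ
≈-setoid = record { isEquivalence = ≈-isEquivalence }

open IsEquivalence ≈-isEquivalence public
  using () renaming (refl to ≈-refl; sym to ≈-sym; trans to ≈-trans)

coeff-+P : ∀ p q k → coeff (p +P q) k ≡ coeff p k + coeff q k
coeff-+P []      q       k       = refl
coeff-+P (a ∷ p) []      k       = sym (+-identityʳ _)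
coeff-+P (a ∷ p) (b ∷ q) zero    = refl
coeff-+P (a ∷ p) (b ∷ q) (suc k) = coeff-+P p q k

coeff-map-* : ∀ a p k → coeff (map (a *_) p) k ≡ a * coeff p k
coeff-map-* a []      k       = sym (*-zeroʳ a)
coeff-map-* a (b ∷ p) zero    = refl
coeff-map-* a (b ∷ p) (suc k) = coeff-map-* a p k

coeff-∷*P-zero : ∀ a p q → coeff ((a ∷ p) *P q) 0 ≡ a * coeff q 0
coeff-∷*P-zero a p q =
  trans (coeff-+P (map (a *_) q) _ 0) (trans (+-identityʳ _) (coeff-map-* a q 0))

coeff-∷*P-suc : ∀ a p q k → coeff ((a ∷ p) *P q) (suc k) ≡ a * coeff q (suc k) + coeff (p *P q) k
coeff-∷*P-suc a p q k =
  trans (coeff-+P (map (a *_) q) _ (suc k)) (cong (_+ coeff (p *P q) k) (coeff-map-* a q (suc k)))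

∷-cong : ∀ {a b p q} → a ≡ b → p ≈ q → a ∷ p ≈ b ∷ q
∷-cong a≡b p≈q = mk≈ λ { zero → a≡b ; (suc k) → coeff-≡ p≈q k }

+P-cong : ∀ {p p′ q q′} → p ≈ p′ → q ≈ q′ → p +P q ≈ p′ +P q′
+P-cong {p} {p′} {q} {q′} e f = mk≈ λ k → begin
  coeff (p +P q) k         ≡⟨ coeff-+P p q k ⟩
  coeff p k + coeff q k    ≡⟨ cong₂ _+_ (coeff-≡ e k) (coeff-≡ f k) ⟩
  coeff p′ k + coeff q′ k  ≡⟨ coeff-+P p′ q′ k ⟨
  coeff (p′ +P q′) k       ∎
  where open ≡-Reasoning

+P-comm : ∀ p q → p +P q ≈ q +P p
+P-comm p q = mk≈ λ k →
  trans (coeff-+P p q k) (trans (+-comm (coeff p k) _) (sym (coeff-+P q p k)))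

+P-assoc : ∀ p q r → (p +P q) +P r ≈ p +P (q +P r)
+P-assoc p q r = mk≈ λ k → begin
  coeff ((p +P q) +P r) k                ≡⟨ coeff-+P (p +P q) r k ⟩
  coeff (p +P q) k + coeff r k           ≡⟨ cong (_+ coeff r k) (coeff-+P p q k) ⟩
  (coeff p k + coeff q k) + coeff r k    ≡⟨ +-assoc (coeff p k) _ _ ⟩
  coeff p k + (coeff q k + coeff r k)    ≡⟨ cong (coeff p k +_) (coeff-+P q r k) ⟨
  coeff p k + coeff (q +P r) k           ≡⟨ coeff-+P p (q +P r) k ⟨
  coeff (p +P (q +P r)) k                ∎
  where open ≡-Reasoning

+P-identityʳ : ∀ p → p +P [] ≈ p
+P-identityʳ p = mk≈ λ k → trans (coeff-+P p [] k) (+-identityʳ _)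

+P-commutativeSemigroup : CommutativeSemigroup 0ℓ 0ℓ
+P-commutativeSemigroup = record
  { isCommutativeSemigroup = record
    { isSemigroup = record
      { isMagma = record { isEquivalence = ≈-isEquivalence ; ∙-cong = +P-cong }
      ; assoc   = +P-assoc }
    ; comm = +P-comm } }

module +P = CommSemigroupProperties +P-commutativeSemigroup

map-*-cong : ∀ a {p q} → p ≈ q → map (a *_) p ≈ map (a *_) q
map-*-cong a {p} {q} e = mk≈ λ k →
  trans (coeff-map-* a p k) (trans (cong (a *_) (coeff-≡ e k)) (sym (coeff-map-* a q k)))

map-*-+P : ∀ a p q → map (a *_) (p +P q) ≈ map (a *_) p +P map (a *_) q
map-*-+P a p q = mk≈ λ k → begin
  coeff (map (a *_) (p +P q)) k                ≡⟨ coeff-map-* a (p +P q) k ⟩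
  a * coeff (p +P q) k                         ≡⟨ cong (a *_) (coeff-+P p q k) ⟩
  a * (coeff p k + coeff q k)                  ≡⟨ *-distribˡ-+ a (coeff p k) _ ⟩
  a * coeff p k + a * coeff q k                ≡⟨ cong₂ _+_ (coeff-map-* a p k) (coeff-map-* a q k) ⟨
  coeff (map (a *_) p) k + coeff (map (a *_) q) k ≡⟨ coeff-+P (map (a *_) p) _ k ⟨
  coeff (map (a *_) p +P map (a *_) q) k       ∎
  where open ≡-Reasoning

map-+-* : ∀ a b p → map ((a + b) *_) p ≈ map (a *_) p +P map (b *_) p
map-+-* a b p = mk≈ λ k → begin
  coeff (map ((a + b) *_) p) k                 ≡⟨ coeff-map-* (a + b) p k ⟩
  (a + b) * coeff p k                          ≡⟨ *-distribʳ-+ (coeff p k) a b ⟩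
  a * coeff p k + b * coeff p k                ≡⟨ cong₂ _+_ (coeff-map-* a p k) (coeff-map-* b p k) ⟨
  coeff (map (a *_) p) k + coeff (map (b *_) p) k ≡⟨ coeff-+P (map (a *_) p) _ k ⟨
  coeff (map (a *_) p +P map (b *_) p) k       ∎
  where open ≡-Reasoning

map-*-map-* : ∀ a b p → map (a *_) (map (b *_) p) ≈ map ((a * b) *_) p
map-*-map-* a b p = mk≈ λ k → begin
  coeff (map (a *_) (map (b *_) p)) k  ≡⟨ coeff-map-* a (map (b *_) p) k ⟩
  a * coeff (map (b *_) p) k           ≡⟨ cong (a *_) (coeff-map-* b p k) ⟩
  a * (b * coeff p k)                  ≡⟨ *-assoc a b _ ⟨
  a * b * coeff p k                    ≡⟨ coeff-map-* (a * b) p k ⟨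
  coeff (map ((a * b) *_) p) k         ∎
  where open ≡-Reasoning

*P-congʳ : ∀ p {q q′} → q ≈ q′ → p *P q ≈ p *P q′
*P-congʳ []      e = ≈-refl
*P-congʳ (a ∷ p) e = +P-cong (map-*-cong a e) (∷-cong refl (*P-congʳ p e))

*P-zeroʳ : ∀ p → p *P [] ≈ []
*P-zeroʳ []      = ≈-refl
*P-zeroʳ (a ∷ p) = mk≈ λ { zero → refl ; (suc k) → coeff-≡ (*P-zeroʳ p) k }

0∷-*P : ∀ p q → (0 ∷ p) *P q ≈ 0 ∷ (p *P q)
0∷-*P p q = mk≈ λ { zero → coeff-∷*P-zero 0 p q ; (suc k) → coeff-∷*P-suc 0 p q k }

*P-∷ : ∀ p b q → p *P (b ∷ q) ≈ map (b *_) p +P (0 ∷ (p *P q))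
*P-∷ []      b q = mk≈ λ { zero → refl ; (suc k) → refl }
*P-∷ (a ∷ p) b q = mk≈ λ
  { zero    → trans (coeff-∷*P-zero a p (b ∷ q)) (trans (*-comm a b) (sym (+-identityʳ _)))
  ; (suc k) → step k }
  where
  open ≡-Reasoning
  tail≡ : ∀ k → a * coeff q k + coeff (0 ∷ (p *P q)) k ≡ coeff ((a ∷ p) *P q) k
  tail≡ zero    = trans (+-identityʳ _) (sym (coeff-∷*P-zero a p q))
  tail≡ (suc k) = sym (coeff-∷*P-suc a p q k)
  step : ∀ k → coeff ((a ∷ p) *P (b ∷ q)) (suc k)
             ≡ coeff (map (b *_) (a ∷ p) +P (0 ∷ ((a ∷ p) *P q))) (suc k)
  step k = begin
    coeff ((a ∷ p) *P (b ∷ q)) (suc k)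
      ≡⟨ coeff-∷*P-suc a p (b ∷ q) k ⟩
    a * coeff q k + coeff (p *P (b ∷ q)) k
      ≡⟨ cong (a * coeff q k +_) (coeff-≡ (*P-∷ p b q) k) ⟩
    a * coeff q k + coeff (map (b *_) p +P (0 ∷ (p *P q))) k
      ≡⟨ cong (a * coeff q k +_) (coeff-+P (map (b *_) p) _ k) ⟩
    a * coeff q k + (coeff (map (b *_) p) k + coeff (0 ∷ (p *P q)) k)
      ≡⟨ ℕ+.x∙yz≈y∙xz (a * coeff q k) (coeff (map (b *_) p) k) _ ⟩
    coeff (map (b *_) p) k + (a * coeff q k + coeff (0 ∷ (p *P q)) k)
      ≡⟨ cong (coeff (map (b *_) p) k +_) (tail≡ k) ⟩
    coeff (map (b *_) p) k + coeff ((a ∷ p) *P q) k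
      ≡⟨ coeff-+P (map (b *_) (a ∷ p)) (0 ∷ ((a ∷ p) *P q)) (suc k) ⟨
    coeff (map (b *_) (a ∷ p) +P (0 ∷ ((a ∷ p) *P q))) (suc k)
      ∎

*P-comm : ∀ p q → p *P q ≈ q *P p
*P-comm []      q = ≈-sym (*P-zeroʳ q)
*P-comm (a ∷ p) q = ≈-trans (+P-cong ≈-refl (∷-cong refl (*P-comm p q))) (≈-sym (*P-∷ q a p))

*P-congˡ : ∀ {p p′} q → p ≈ p′ → p *P q ≈ p′ *P q
*P-congˡ {p} {p′} q e = ≈-trans (*P-comm p q) (≈-trans (*P-congʳ q e) (*P-comm q p′))

*P-cong : ∀ {p p′ q q′} → p ≈ p′ → q ≈ q′ → p *P q ≈ p′ *P q′
*P-cong {p′ = p′} {q = q} e f = ≈-trans (*P-congˡ q e) (*P-congʳ p′ f)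

map-*-*P : ∀ a p q → map (a *_) p *P q ≈ map (a *_) (p *P q)
map-*-*P a []      q = ≈-refl
map-*-*P a (b ∷ p) q =
  ≈-trans (+P-cong (≈-sym (map-*-map-* a b q)) (∷-cong (sym (*-zeroʳ a)) (map-*-*P a p q)))
          (≈-sym (map-*-+P a (map (b *_) q) (0 ∷ (p *P q))))

*P-distribʳ : ∀ p p′ q → (p +P p′) *P q ≈ p *P q +P p′ *P q
*P-distribʳ []      p′       q = ≈-refl
*P-distribʳ (a ∷ p) []       q = ≈-sym (+P-identityʳ _)
*P-distribʳ (a ∷ p) (b ∷ p′) q =
  ≈-trans (+P-cong (map-+-* a b q) (∷-cong refl (*P-distribʳ p p′ q)))
          (+P.interchange (map (a *_) q) (map (b *_) q) (0 ∷ (p *P q)) (0 ∷ (p′ *P q)))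

*P-distribˡ : ∀ p q q′ → p *P (q +P q′) ≈ p *P q +P p *P q′
*P-distribˡ p q q′ =
  ≈-trans (*P-comm p _) (≈-trans (*P-distribʳ q q′ p) (+P-cong (*P-comm q p) (*P-comm q′ p)))

*P-assoc : ∀ p q r → (p *P q) *P r ≈ p *P (q *P r)
*P-assoc []      q r = ≈-refl
*P-assoc (a ∷ p) q r =
  ≈-trans (*P-distribʳ (map (a *_) q) (0 ∷ (p *P q)) r)
          (+P-cong (map-*-*P a q r) (≈-trans (0∷-*P (p *P q) r) (∷-cong refl (*P-assoc p q r))))

*P-identityˡ : ∀ p → (1 ∷ []) *P p ≈ p
*P-identityˡ p = mk≈ λ k → begin
  coeff (map (1 *_) p +P (0 ∷ [])) k      ≡⟨ coeff-+P (map (1 *_) p) _ k ⟩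
  coeff (map (1 *_) p) k + coeff (0 ∷ []) k ≡⟨ cong₂ _+_ (coeff-map-* 1 p k) (coeff-0∷[] k) ⟩
  1 * coeff p k + 0                       ≡⟨ trans (+-identityʳ _) (*-identityˡ _) ⟩
  coeff p k                               ∎
  where
  open ≡-Reasoning
  coeff-0∷[] : ∀ k → coeff (0 ∷ []) k ≡ 0
  coeff-0∷[] zero    = refl
  coeff-0∷[] (suc k) = refl

*P-identityʳ : ∀ p → p *P (1 ∷ []) ≈ p
*P-identityʳ p = ≈-trans (*P-comm p _) (*P-identityˡ p)

*P-commutativeSemigroup : CommutativeSemigroup 0ℓ 0ℓ
*P-commutativeSemigroup = record
  { isCommutativeSemigroup = record
    { isSemigroup = record
      { isMagma = record { isEquivalence = ≈-isEquivalence ; ∙-cong = *P-cong }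
      ; assoc   = *P-assoc }
    ; comm = *P-comm } }

module *P = CommSemigroupProperties *P-commutativeSemigroup

shift : ℕ → Poly → Poly
shift zero    p = p
shift (suc n) p = 0 ∷ shift n p

shift-cong : ∀ n {p q} → p ≈ q → shift n p ≈ shift n q
shift-cong zero    e = e
shift-cong (suc n) e = ∷-cong refl (shift-cong n e)

shift-*P : ∀ n p q → shift n p *P q ≈ shift n (p *P q)
shift-*P zero    p q = ≈-refl
shift-*P (suc n) p q = ≈-trans (0∷-*P (shift n p) q) (∷-cong refl (shift-*P n p q))

*P-shift : ∀ n p q → p *P shift n q ≈ shift n (p *P q)
*P-shift n p q =
  ≈-trans (*P-comm p _) (≈-trans (shift-*P n q p) (shift-cong n (*P-comm q p)))

qInt-+ : ∀ a b → qInt a +P shift a (qInt b) ≡ qInt (a + b)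
qInt-+ zero    b = refl
qInt-+ (suc a) b = cong (1 ∷_) (qInt-+ a b)

-- Gaussian polynomials

-- gauss r g is the q-binomial [r+g over r], given by the q-Pascal recurrence.
gauss : ℕ → ℕ → Poly
gauss zero    g       = 1 ∷ []
gauss (suc r) zero    = gauss r zero
gauss (suc r) (suc g) = gauss r (suc g) +P shift (suc r) (gauss (suc r) g)

gauss-*P-qFact : ∀ r g → gauss r g *P (qFact g *P qFact r) ≈ qFact (r + g)
gauss-*P-qFact zero    g    = ≈-trans (*P-identityˡ _) (*P-identityʳ (qFact g))
gauss-*P-qFact (suc r) zero rewrite +-identityʳ r =
  ≈-trans (*P-cong (gauss-zeroʳ r) (*P-identityˡ _)) (*P-identityˡ _)
  where
  gauss-zeroʳ : ∀ r → gauss r 0 ≈ 1 ∷ []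
  gauss-zeroʳ zero    = ≈-refl
  gauss-zeroʳ (suc r) = gauss-zeroʳ r
gauss-*P-qFact (suc r) (suc g) = begin
  (gauss r (suc g) +P shift (suc r) (gauss (suc r) g)) *P (qFact (suc g) *P qFact (suc r))
    ≈⟨ *P-distribʳ (gauss r (suc g)) _ _ ⟩
  gauss r (suc g) *P (qFact (suc g) *P (qFact r *P qInt (suc r)))
    +P shift (suc r) (gauss (suc r) g) *P ((qFact g *P qInt (suc g)) *P qFact (suc r))
    ≈⟨ +P-cong left (≈-trans (shift-*P (suc r) _ _) (shift-cong (suc r) right)) ⟩
  N *P qInt (suc r) +P shift (suc r) (N *P qInt (suc g))
    ≈⟨ +P-cong ≈-refl (≈-sym (*P-shift (suc r) N (qInt (suc g)))) ⟩
  N *P qInt (suc r) +P N *P shift (suc r) (qInt (suc g))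
    ≈⟨ *P-distribˡ N (qInt (suc r)) _ ⟨
  N *P (qInt (suc r) +P shift (suc r) (qInt (suc g)))
    ≡⟨ cong (N *P_) (qInt-+ (suc r) (suc g)) ⟩
  N *P qInt (suc r + suc g)
    ≡⟨ cong (λ n → N *P qInt (suc n)) (+-suc r g) ⟩
  N *P qInt (suc (suc (r + g)))
    ≡⟨ cong (λ n → qFact n *P qInt (suc n)) (sym (+-suc r g)) ⟩
  qFact (suc r + suc g)
    ∎
  where
  open SetoidReasoning ≈-setoid
  N : Poly
  N = qFact (suc (r + g))
  left : gauss r (suc g) *P (qFact (suc g) *P (qFact r *P qInt (suc r))) ≈ N *P qInt (suc r)
  left = begin
    gauss r (suc g) *P (qFact (suc g) *P (qFact r *P qInt (suc r)))
      ≈⟨ *P-congʳ (gauss r (suc g)) (*P.x∙yz≈xy∙z (qFact (suc g)) _ _) ⟩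
    gauss r (suc g) *P ((qFact (suc g) *P qFact r) *P qInt (suc r))
      ≈⟨ *P.x∙yz≈xy∙z (gauss r (suc g)) _ _ ⟩
    (gauss r (suc g) *P (qFact (suc g) *P qFact r)) *P qInt (suc r)
      ≈⟨ *P-congˡ (qInt (suc r)) (gauss-*P-qFact r (suc g)) ⟩
    qFact (r + suc g) *P qInt (suc r)
      ≡⟨ cong (λ n → qFact n *P qInt (suc r)) (+-suc r g) ⟩
    N *P qInt (suc r)
      ∎
  right : gauss (suc r) g *P ((qFact g *P qInt (suc g)) *P qFact (suc r)) ≈ N *P qInt (suc g)
  right = begin
    gauss (suc r) g *P ((qFact g *P qInt (suc g)) *P qFact (suc r))
      ≈⟨ *P-congʳ (gauss (suc r) g) (*P.xy∙z≈xz∙y (qFact g) _ _) ⟩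
    gauss (suc r) g *P ((qFact g *P qFact (suc r)) *P qInt (suc g))
      ≈⟨ *P.x∙yz≈xy∙z (gauss (suc r) g) _ _ ⟩
    (gauss (suc r) g *P (qFact g *P qFact (suc r))) *P qInt (suc g)
      ≈⟨ *P-congˡ (qInt (suc g)) (gauss-*P-qFact (suc r) g) ⟩
    N *P qInt (suc g)
      ∎

-- Rank-generating functions

ℕ-≡-↔ : {a b c d : ℕ} → (a ≡ b → c ≡ d) → (c ≡ d → a ≡ b) → (a ≡ b) ↔ (c ≡ d)
ℕ-≡-↔ f g = mk↔ₛ′ f g (λ _ → ≡-irrelevant _ _) (λ _ → ≡-irrelevant _ _)

IsRankGenFun-↔ : ∀ {A B : Set} {rkA : A → ℕ} {rkB : B → ℕ} {F} (e : A ↔ B) →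
                 (∀ x → rkB (Inverse.to e x) ≡ rkA x) →
                 IsRankGenFun A rkA F → IsRankGenFun B rkB F
IsRankGenFun-↔ e rk-to h k =
  Σ-↔ e (λ {x} → ℕ-≡-↔ (trans (rk-to x)) (trans (sym (rk-to x)))) ↔-∘ h k

IsRankGenFun-⊤ : IsRankGenFun ⊤ (λ _ → 0) (1 ∷ [])
IsRankGenFun-⊤ zero    = mk↔ₛ′ (λ _ → tt , refl) (λ _ → zero)
                               (λ (tt , p) → cong (tt ,_) (≡-irrelevant refl p)) (λ { zero → refl })
IsRankGenFun-⊤ (suc k) = mk↔ₛ′ (λ ()) (λ { (_ , ()) }) (λ { (_ , ()) }) (λ ())

IsRankGenFun-⊎ : ∀ {A B : Set} {rkA : A → ℕ} {rkB : B → ℕ} {F G} →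
                 IsRankGenFun A rkA F → IsRankGenFun B rkB G →
                 IsRankGenFun (A ⊎ B) [ rkA , rkB ]′ (F +P G)
IsRankGenFun-⊎ {F = F} {G} hA hB k =
  subst (λ n → Fin n ↔ _) (sym (coeff-+P F G k))
        (↔-sym Σ-distribʳ-⊎ ↔-∘ ((hA k ⊎-↔ hB k) ↔-∘ +↔⊎))

IsRankGenFun-suc : ∀ {A : Set} {rk : A → ℕ} {F} →
                   IsRankGenFun A rk F → IsRankGenFun A (λ x → suc (rk x)) (0 ∷ F)
IsRankGenFun-suc h zero    = mk↔ₛ′ (λ ()) (λ { (_ , ()) }) (λ { (_ , ()) }) (λ ())
IsRankGenFun-suc h (suc k) = Σ-↔ ↔-refl (ℕ-≡-↔ (cong suc) suc-injective) ↔-∘ h k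

IsRankGenFun-shift : ∀ n {A : Set} {rk : A → ℕ} {F} →
                     IsRankGenFun A rk F → IsRankGenFun A (λ x → n + rk x) (shift n F)
IsRankGenFun-shift zero    h = h
IsRankGenFun-shift (suc n) h = IsRankGenFun-suc (IsRankGenFun-shift n h)

convolution : (ℕ → ℕ) → (ℕ → ℕ) → ℕ → ℕ
convolution f g zero    = f 0 * g 0
convolution f g (suc k) = f 0 * g (suc k) + convolution (λ i → f (suc i)) g k

coeff-*P : ∀ p q k → coeff (p *P q) k ≡ convolution (coeff p) (coeff q) k
coeff-*P []      q k       = sym (convolution-zeroˡ k)
  where
  convolution-zeroˡ : ∀ k → convolution (λ _ → 0) (coeff q) k ≡ 0
  convolution-zeroˡ zero    = refl
  convolution-zeroˡ (suc k) = convolution-zeroˡ k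
coeff-*P (a ∷ p) q zero    = coeff-∷*P-zero a p q
coeff-*P (a ∷ p) q (suc k) =
  trans (coeff-∷*P-suc a p q k) (cong (a * coeff q (suc k) +_) (coeff-*P p q k))

Convolution : (ℕ → Set) → (ℕ → Set) → ℕ → Set
Convolution X Y k = Σ ℕ λ i → Σ ℕ λ j → i + j ≡ k × X i × Y j

Convolution-zero : ∀ X Y → Convolution X Y 0 ↔ (X 0 × Y 0)
Convolution-zero X Y = mk↔ₛ′ to (λ (x , y) → 0 , 0 , refl , x , y) (λ _ → refl) from∘to
  where
  to : Convolution X Y 0 → X 0 × Y 0
  to (zero , zero , refl , x , y) = x , y
  from∘to : ∀ c → (0 , 0 , refl , to c) ≡ c
  from∘to (zero , zero , refl , x , y) = refl

Convolution-suc : ∀ X Y k →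
                  Convolution X Y (suc k) ↔ ((X 0 × Y (suc k)) ⊎ Convolution (λ i → X (suc i)) Y k)
Convolution-suc X Y k = mk↔ₛ′ to from to∘from from∘to
  where
  to : Convolution X Y (suc k) → (X 0 × Y (suc k)) ⊎ Convolution (λ i → X (suc i)) Y k
  to (zero  , j , refl , x , y) = inj₁ (x , y)
  to (suc i , j , i+j≡k , x , y) = inj₂ (i , j , suc-injective i+j≡k , x , y)
  from : (X 0 × Y (suc k)) ⊎ Convolution (λ i → X (suc i)) Y k → Convolution X Y (suc k)
  from (inj₁ (x , y))              = 0 , suc k , refl , x , y
  from (inj₂ (i , j , i+j≡k , x , y)) = suc i , j , cong suc i+j≡k , x , y
  to∘from : ∀ c → to (from c) ≡ c
  to∘from (inj₁ _)                    = refl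
  to∘from (inj₂ (i , j , i+j≡k , x , y)) =
    cong (λ e → inj₂ (i , j , e , x , y)) (≡-irrelevant _ _)
  from∘to : ∀ c → from (to c) ≡ c
  from∘to (zero  , j , refl , x , y)  = refl
  from∘to (suc i , j , i+j≡k , x , y) = cong (λ e → suc i , j , e , x , y) (≡-irrelevant _ _)

Fin-convolution : ∀ {f g : ℕ → ℕ} {X Y : ℕ → Set} →
                  (∀ i → Fin (f i) ↔ X i) → (∀ j → Fin (g j) ↔ Y j) →
                  ∀ k → Fin (convolution f g k) ↔ Convolution X Y k
Fin-convolution {X = X} {Y} hX hY zero =
  ↔-sym (Convolution-zero X Y) ↔-∘ ((hX 0 ×-↔ hY 0) ↔-∘ *↔×)
Fin-convolution {X = X} {Y} hX hY (suc k) =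
  ↔-sym (Convolution-suc X Y k)
    ↔-∘ ((((hX 0 ×-↔ hY (suc k)) ↔-∘ *↔×) ⊎-↔ Fin-convolution (λ i → hX (suc i)) hY k)
    ↔-∘ +↔⊎)

Convolution-fibers : ∀ {A B : Set} (rkA : A → ℕ) (rkB : B → ℕ) k →
                     Convolution (λ i → Σ A (λ a → rkA a ≡ i)) (λ j → Σ B (λ b → rkB b ≡ j)) k
                     ↔ Σ (A × B) (λ (a , b) → rkA a + rkB b ≡ k)
Convolution-fibers rkA rkB k = mk↔ₛ′
  (λ (i , j , i+j≡k , (a , p) , (b , q)) → (a , b) , trans (cong₂ _+_ p q) i+j≡k)
  (λ ((a , b) , e) → rkA a , rkB b , e , (a , refl) , (b , refl))
  (λ _ → refl)
  (λ { (i , j , i+j≡k , (a , refl) , (b , refl)) → refl })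

IsRankGenFun-× : ∀ {A B : Set} {rkA : A → ℕ} {rkB : B → ℕ} {F G} →
                 IsRankGenFun A rkA F → IsRankGenFun B rkB G →
                 IsRankGenFun (A × B) (λ (a , b) → rkA a + rkB b) (F *P G)
IsRankGenFun-× {rkA = rkA} {rkB} {F} {G} hA hB k =
  subst (λ n → Fin n ↔ _) (sym (coeff-*P F G k))
        (Convolution-fibers rkA rkB k ↔-∘ Fin-convolution hA hB k)

-- Weakly increasing sequences

Σ-≡-irrelevant : ∀ {A : Set} {P : A → Set} → U.Irrelevant P →
                 {x y : Σ A P} → proj₁ x ≡ proj₁ y → x ≡ y
Σ-≡-irrelevant irr {x , p} {.x , q} refl = cong (x ,_) (irr p q)

0∷-linked : ∀ {y} → Linked _≤_ y → Linked _≤_ (0 ∷ y)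
0∷-linked {[]}    lk = [-]
0∷-linked {_ ∷ _} lk = z≤n ∷ lk

sum-map-suc : ∀ y → sum (map suc y) ≡ length y + sum y
sum-map-suc []      = refl
sum-map-suc (a ∷ y) = cong suc (trans (cong (a +_) (sum-map-suc y)) (ℕ+.x∙yz≈y∙xz a (length y) (sum y)))

map-suc-pred : ∀ {y} → All (1 ≤_) y → map suc (map pred y) ≡ y
map-suc-pred {y} y≥1 = trans (sym (map-∘ y)) (map-id-local (All.map (λ { (s≤s z≤n) → refl }) y≥1))

IsIncreasing : ℕ → ℕ → List ℕ → Set
IsIncreasing g r y = length y ≡ r × Linked _≤_ y × All (_≤ g) y

Increasing : ℕ → ℕ → Set
Increasing g r = Σ (List ℕ) (IsIncreasing g r)

IsIncreasing-irrelevant : ∀ {g r} → U.Irrelevant (IsIncreasing g r)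
IsIncreasing-irrelevant (l , lk , b) (l′ , lk′ , b′) =
  cong₂ _,_ (≡-irrelevant l l′)
    (cong₂ _,_ (Linked.irrelevant ≤-irrelevant lk lk′) (All.irrelevant ≤-irrelevant b b′))

0∷-Increasing : ∀ {g r} → Increasing g r → Increasing g (suc r)
0∷-Increasing (y , l , lk , b) = 0 ∷ y , cong suc l , 0∷-linked lk , z≤n ∷ b

Increasing-zero↔ : ∀ g → Increasing g 0 ↔ ⊤
Increasing-zero↔ g = mk↔ₛ′ _ (λ _ → [] , refl , [] , []) (λ _ → refl) from∘to
  where
  from∘to : ∀ y → ([] , refl , [] , []) ≡ y
  from∘to ([] , _) = Σ-≡-irrelevant IsIncreasing-irrelevant refl

Increasing-suc-zero↔ : ∀ r → Increasing 0 r ↔ Increasing 0 (suc r)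
Increasing-suc-zero↔ r = mk↔ₛ′ 0∷-Increasing from to∘from from∘to
  where
  from : Increasing 0 (suc r) → Increasing 0 r
  from (_ ∷ y , l , lk , _ ∷ b) = y , suc-injective l , Linked.tail lk , b
  to∘from : ∀ y → 0∷-Increasing (from y) ≡ y
  to∘from (.0 ∷ y , _ , _ , z≤n ∷ _) = Σ-≡-irrelevant IsIncreasing-irrelevant refl
  from∘to : ∀ y → from (0∷-Increasing y) ≡ y
  from∘to _ = Σ-≡-irrelevant IsIncreasing-irrelevant refl

-- A sequence in [0, g+1] starts with 0 or is the successor of a sequence in [0, g].
Increasing-suc-suc↔ : ∀ g r → (Increasing (suc g) r ⊎ Increasing g (suc r)) ↔ Increasing (suc g) (suc r)
Increasing-suc-suc↔ g r = mk↔ₛ′ to from to∘from from∘to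
  where
  to : Increasing (suc g) r ⊎ Increasing g (suc r) → Increasing (suc g) (suc r)
  to (inj₁ y)                = 0∷-Increasing y
  to (inj₂ (y , l , lk , b)) =
    map suc y , trans (length-map suc y) l , Linked.map⁺ (Linked.map s≤s lk) , All.map⁺ (All.map s≤s b)
  from : Increasing (suc g) (suc r) → Increasing (suc g) r ⊎ Increasing g (suc r)
  from (zero  ∷ y , l , lk , _ ∷ b) = inj₁ (y , suc-injective l , Linked.tail lk , b)
  from (suc a ∷ y , l , lk , b)     = inj₂ (map pred (suc a ∷ y) , trans (length-map pred (suc a ∷ y)) l ,
                                            Linked.map⁺ (Linked.map pred-mono-≤ lk) ,
                                            All.map⁺ (All.map pred-mono-≤ b))
  to∘from : ∀ y → to (from y) ≡ y
  to∘from (zero  ∷ y , _ , _ , _ ∷ _) = Σ-≡-irrelevant IsIncreasing-irrelevant refl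
  to∘from (suc a ∷ y , _ , lk , _) = Σ-≡-irrelevant IsIncreasing-irrelevant
    (map-suc-pred (Linked⇒All ≤-trans (s≤s z≤n) lk))
  from∘to : ∀ y → from (to y) ≡ y
  from∘to (inj₁ y)          = cong inj₁ (Σ-≡-irrelevant IsIncreasing-irrelevant refl)
  from∘to (inj₂ (a ∷ y , _)) = cong inj₂ (Σ-≡-irrelevant IsIncreasing-irrelevant
    (trans (sym (map-∘ (a ∷ y))) (map-id (a ∷ y))))

IsRankGenFun-Increasing : ∀ g r → IsRankGenFun (Increasing g r) (sum ∘ proj₁) (gauss r g)
IsRankGenFun-Increasing g zero =
  IsRankGenFun-↔ {F = 1 ∷ []} (↔-sym (Increasing-zero↔ g)) (λ _ → refl) IsRankGenFun-⊤
IsRankGenFun-Increasing zero (suc r) =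
  IsRankGenFun-↔ {F = gauss r 0} (Increasing-suc-zero↔ r) (λ _ → refl) (IsRankGenFun-Increasing zero r)
IsRankGenFun-Increasing (suc g) (suc r) =
  IsRankGenFun-↔ {F = gauss (suc r) (suc g)} (Increasing-suc-suc↔ g r) rank-to
    (IsRankGenFun-⊎ {F = gauss r (suc g)} (IsRankGenFun-Increasing (suc g) r)
      (IsRankGenFun-shift (suc r) {F = gauss (suc r) g} (IsRankGenFun-Increasing g (suc r))))
  where
  rank-to : ∀ y → sum (proj₁ (Inverse.to (Increasing-suc-suc↔ g r) y))
                ≡ [ sum ∘ proj₁ , (λ y → suc r + sum (proj₁ y)) ]′ y
  rank-to (inj₁ y)            = refl
  rank-to (inj₂ (y , l , _)) = trans (sum-map-suc y) (cong (_+ sum y) l)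

-- V(m)

Increasings : List ℕ → Set
Increasings []        = ⊤
Increasings (mi ∷ ms) = Increasing (sum ms) (pred mi) × Increasings ms

rankIncreasings : ∀ m → Increasings m → ℕ
rankIncreasings []        _        = 0
rankIncreasings (mi ∷ ms) (y , ys) = sum (proj₁ y) + rankIncreasings ms ys

gaussProduct : List ℕ → Poly
gaussProduct []        = 1 ∷ []
gaussProduct (mi ∷ ms) = gauss (pred mi) (sum ms) *P gaussProduct ms

IsRankGenFun-Increasings : ∀ m → IsRankGenFun (Increasings m) (rankIncreasings m) (gaussProduct m)
IsRankGenFun-Increasings []        = IsRankGenFun-⊤
IsRankGenFun-Increasings (mi ∷ ms) =
  IsRankGenFun-× {F = gauss (pred mi) (sum ms)} {G = gaussProduct ms}
    (IsRankGenFun-Increasing (sum ms) (pred mi)) (IsRankGenFun-Increasings ms)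

Block-irrelevant : ∀ {mi bound} → U.Irrelevant (Block mi bound)
Block-irrelevant (l , hd , lk , b) (l′ , hd′ , lk′ , b′) =
  cong₂ _,_ (≡-irrelevant l l′)
    (cong₂ _,_ (Decidable⇒UIP.≡-irrelevant (Maybe.≡-dec _≟_) hd hd′)
      (cong₂ _,_ (Linked.irrelevant ≤-irrelevant lk lk′) (All.irrelevant ≤-irrelevant b b′)))

Block↔Increasing : ∀ r bound → Σ (List ℕ) (Block (suc r) bound) ↔ Increasing bound r
Block↔Increasing r bound = mk↔ₛ′ to from to∘from from∘to
  where
  to : Σ (List ℕ) (Block (suc r) bound) → Increasing bound r
  to (0 ∷ y , l , refl , lk , _ ∷ b) = y , suc-injective l , Linked.tail lk , b
  from : Increasing bound r → Σ (List ℕ) (Block (suc r) bound)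
  from (y , l , lk , b) = 0 ∷ y , cong suc l , refl , 0∷-linked lk , z≤n ∷ b
  to∘from : ∀ y → to (from y) ≡ y
  to∘from _ = Σ-≡-irrelevant IsIncreasing-irrelevant refl
  from∘to : ∀ x → from (to x) ≡ x
  from∘to (0 ∷ y , _ , refl , _ , _ ∷ _) = Σ-≡-irrelevant Block-irrelevant refl

V-∷↔ : ∀ mi ms → V (mi ∷ ms) ↔ (Σ (List ℕ) (Block mi (sum ms)) × V ms)
V-∷↔ mi ms = mk↔ₛ′ (λ { (x ∷ xs , b ∷ v) → (x , b) , (xs , v) })
                   (λ ((x , b) , (xs , v)) → x ∷ xs , b ∷ v)
                   (λ _ → refl) (λ { (x ∷ xs , b ∷ v) → refl })

Increasings↔V : ∀ m → All (1 ≤_) m → Increasings m ↔ V m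
Increasings↔V []            _       = mk↔ₛ′ (λ _ → [] , []) _ (λ { ([] , []) → refl }) (λ _ → refl)
Increasings↔V (suc r ∷ ms) (_ ∷ h) =
  ↔-sym (V-∷↔ (suc r) ms) ↔-∘ (↔-sym (Block↔Increasing r (sum ms)) ×-↔ Increasings↔V ms h)

rankV-Increasings↔V : ∀ m (h : All (1 ≤_) m) y → rankV (Inverse.to (Increasings↔V m h) y) ≡ rankIncreasings m y
rankV-Increasings↔V []           _       _        = refl
rankV-Increasings↔V (suc r ∷ ms) (_ ∷ h) (y , ys) = cong (sum (proj₁ y) +_) (rankV-Increasings↔V ms h ys)

IsRankGenFun-V : ∀ m → All (1 ≤_) m → IsRankGenFun (V m) rankV (gaussProduct m)
IsRankGenFun-V m h =
  IsRankGenFun-↔ {F = gaussProduct m} (Increasings↔V m h) (rankV-Increasings↔V m h) (IsRankGenFun-Increasings m)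

-- Words

smaller : ℕ → List ℕ → ℕ
smaller b w = length (filter (_<? b) w)

smaller-∷-< : ∀ {a b} w → a < b → smaller b (a ∷ w) ≡ suc (smaller b w)
smaller-∷-< w a<b = cong length (filter-accept (_<? _) a<b)

smaller-∷ : ∀ b a w → smaller b (a ∷ w) ≡ smaller b (a ∷ []) + smaller b w
smaller-∷ b a w with a <? b
... | yes a<b = trans (smaller-∷-< w a<b) (cong (_+ smaller b w) (sym (smaller-∷-< [] a<b)))
... | no  a≮b = trans (cong length (filter-reject (_<? b) a≮b))
                      (cong (_+ smaller b w) (sym (cong length (filter-reject (_<? b) {xs = []} a≮b))))

smaller-≥ : ∀ {b} w → All (b ≤_) w → smaller b w ≡ 0
smaller-≥ w b≤w = cong length (filter-none (_<? _) (All.map (λ b≤a a<b → <⇒≱ a<b b≤a) b≤w))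

occ-∷-≡ : ∀ a w → occ a (a ∷ w) ≡ suc (occ a w)
occ-∷-≡ a w = cong length (filter-accept (a ≟_) refl)

occ-∷-≢ : ∀ {i a} w → i ≢ a → occ i (a ∷ w) ≡ occ i w
occ-∷-≢ {i} w i≢a = cong length (filter-reject (i ≟_) i≢a)

firstPos-∷-≡ : ∀ a w → firstPos a (a ∷ w) ≡ 0
firstPos-∷-≡ a w with a ≡ᵇ a | ≡⇒≡ᵇ a a refl
... | true | _ = refl

firstPos-∷-≢ : ∀ {i a} w → i ≢ a → firstPos i (a ∷ w) ≡ suc (firstPos i w)
firstPos-∷-≢ {i} {a} w i≢a with i ≡ᵇ a | ≡ᵇ⇒≡ i a
... | false | _   = refl
... | true  | i≡a = contradiction (i≡a _) i≢a

firstPos<-∷ : ∀ {i j a} w →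
              firstPos i (a ∷ w) < firstPos j (a ∷ w)
              ⇔ (i ≡ a × j ≢ a ⊎ i ≢ a × j ≢ a × firstPos i w < firstPos j w)
firstPos<-∷ {i} {j} {a} w with i ≟ a | j ≟ a
... | yes refl | yes refl = mk⇔ (λ h → contradiction h (<-irrefl refl))
                                [ (λ (_ , j≢a) → contradiction refl j≢a) , (λ (i≢a , _) → contradiction refl i≢a) ]′
... | yes refl | no j≢a   = mk⇔ (λ _ → inj₁ (refl , j≢a))
                                (λ _ → subst₂ _<_ (sym (firstPos-∷-≡ a w)) (sym (firstPos-∷-≢ w j≢a)) (s≤s z≤n))
... | no i≢a   | yes refl = mk⇔ (λ h → contradiction (subst (firstPos i (a ∷ w) <_) (firstPos-∷-≡ a w) h) n≮0)
                                [ (λ (i≡a , _) → contradiction i≡a i≢a) , (λ (_ , j≢a , _) → contradiction refl j≢a) ]′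
... | no i≢a   | no j≢a   =
  mk⇔ (λ h → inj₂ (i≢a , j≢a , s≤s⁻¹ (subst₂ _<_ (firstPos-∷-≢ w i≢a) (firstPos-∷-≢ w j≢a) h)))
      [ (λ (i≡a , _) → contradiction i≡a i≢a)
      , (λ (_ , _ , h) → subst₂ _<_ (sym (firstPos-∷-≢ w i≢a)) (sym (firstPos-∷-≢ w j≢a)) (s≤s h)) ]′

module _ (L : ℕ) where

  erase : List ℕ → List ℕ
  erase []      = []
  erase (a ∷ w) with a ≟ L
  ... | yes _ = erase w
  ... | no  _ = a ∷ erase w

  positions : List ℕ → List ℕ
  positions []      = []
  positions (a ∷ w) with a ≟ L
  ... | yes _ = 0 ∷ positions w
  ... | no  _ = map suc (positions w)

  -- The inverse of w ↦ (positions w , erase w).  Positions beyond the end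
  -- of u are junk; they are placed at the end.
  insert : List ℕ → List ℕ → List ℕ
  insert []          u       = u
  insert (zero ∷ c)  u       = L ∷ insert c u
  insert (suc k ∷ c) []      = L ∷ insert c []
  insert (suc k ∷ c) (b ∷ u) = b ∷ insert (k ∷ map pred c) u

  erase-∷-≡ : ∀ w → erase (L ∷ w) ≡ erase w
  erase-∷-≡ w with L ≟ L
  ... | yes _   = refl
  ... | no L≢L = contradiction refl L≢L

  erase-∷-≢ : ∀ {a} w → a ≢ L → erase (a ∷ w) ≡ a ∷ erase w
  erase-∷-≢ {a} w a≢L with a ≟ L
  ... | yes a≡L = contradiction a≡L a≢L
  ... | no  _   = refl

  positions-∷-≡ : ∀ w → positions (L ∷ w) ≡ 0 ∷ positions w
  positions-∷-≡ w with L ≟ L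
  ... | yes _   = refl
  ... | no L≢L = contradiction refl L≢L

  positions-∷-≢ : ∀ {a} w → a ≢ L → positions (a ∷ w) ≡ map suc (positions w)
  positions-∷-≢ {a} w a≢L with a ≟ L
  ... | yes a≡L = contradiction a≡L a≢L
  ... | no  _   = refl

  insert-map-suc : ∀ c a u → insert (map suc c) (a ∷ u) ≡ a ∷ insert c u
  insert-map-suc []      a u = refl
  insert-map-suc (k ∷ c) a u =
    cong (λ c′ → a ∷ insert (k ∷ c′) u) (trans (sym (map-∘ c)) (map-id c))

  insert-positions-erase : ∀ w → insert (positions w) (erase w) ≡ w
  insert-positions-erase []      = refl
  insert-positions-erase (a ∷ w) with a ≟ L
  ... | yes refl = cong (L ∷_) (insert-positions-erase w)
  ... | no  _    = trans (insert-map-suc (positions w) a (erase w)) (cong (a ∷_) (insert-positions-erase w))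

  length-positions : ∀ w → length (positions w) ≡ occ L w
  length-positions []      = refl
  length-positions (a ∷ w) with a ≟ L
  ... | yes refl = trans (cong suc (length-positions w)) (sym (occ-∷-≡ L w))
  ... | no  a≢L  = trans (length-map suc (positions w))
                         (trans (length-positions w) (sym (occ-∷-≢ w (≢-sym a≢L))))

  positions-linked : ∀ w → Linked _≤_ (positions w)
  positions-linked []      = []
  positions-linked (a ∷ w) with a ≟ L
  ... | yes _ = 0∷-linked (positions-linked w)
  ... | no  _ = Linked.map⁺ (Linked.map s≤s (positions-linked w))

  positions-≤ : ∀ w → All (_≤ length (erase w)) (positions w)
  positions-≤ []      = []
  positions-≤ (a ∷ w) with a ≟ L
  ... | yes _ = z≤n ∷ positions-≤ w
  ... | no  _ = All.map⁺ (All.map s≤s (positions-≤ w))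

  length-erase : ∀ w → length w ≡ occ L w + length (erase w)
  length-erase []      = refl
  length-erase (a ∷ w) with a ≟ L
  ... | yes refl = trans (cong suc (length-erase w)) (cong (_+ length (erase w)) (sym (occ-∷-≡ L w)))
  ... | no  a≢L  = trans (cong suc (length-erase w))
                     (trans (sym (+-suc (occ L w) _))
                            (cong (_+ suc (length (erase w))) (sym (occ-∷-≢ w (≢-sym a≢L)))))

  occ-erase : ∀ {b} w → b ≢ L → occ b (erase w) ≡ occ b w
  occ-erase         []      b≢L = refl
  occ-erase {b} (a ∷ w) b≢L with a ≟ L
  ... | yes refl = trans (occ-erase w b≢L) (sym (occ-∷-≢ w b≢L))
  ... | no  _ with b ≟ a
  ...   | yes refl = trans (occ-∷-≡ b (erase w)) (trans (cong suc (occ-erase w b≢L)) (sym (occ-∷-≡ b w)))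
  ...   | no  b≢a  = trans (occ-∷-≢ (erase w) b≢a) (trans (occ-erase w b≢L) (sym (occ-∷-≢ w b≢a)))

  firstPos<-erase : ∀ {i j} w → i ≢ L → j ≢ L →
                    firstPos i w < firstPos j w ⇔ firstPos i (erase w) < firstPos j (erase w)
  firstPos<-erase         []      i≢L j≢L = ⇔-id _
  firstPos<-erase {i} {j} (a ∷ w) i≢L j≢L with a ≟ L
  ... | yes refl =
    firstPos<-erase w i≢L j≢L ⇔-∘
      mk⇔ (λ h → s≤s⁻¹ (subst₂ _<_ (firstPos-∷-≢ w i≢L) (firstPos-∷-≢ w j≢L) h))
          (λ h → subst₂ _<_ (sym (firstPos-∷-≢ w i≢L)) (sym (firstPos-∷-≢ w j≢L)) (s≤s h))
  ... | no _ =
    ⇔-sym (firstPos<-∷ (erase w)) ⇔-∘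
      ((⇔-id _ ⊎-⇔ (⇔-id _ ×-⇔ ⇔-id _ ×-⇔ firstPos<-erase w i≢L j≢L)) ⇔-∘ firstPos<-∷ w)

  All-erase : ∀ {P : ℕ → Set} w → All (λ a → a ≢ L → P a) w → All P (erase w)
  All-erase []      []         = []
  All-erase (a ∷ w) (pa ∷ pw) with a ≟ L
  ... | yes _   = All-erase w pw
  ... | no  a≢L = pa a≢L ∷ All-erase w pw


  erase-insert : ∀ c u → All (_≢ L) u → erase (insert c u) ≡ u
  erase-insert []          []      []           = refl
  erase-insert []          (b ∷ u) (b≢L ∷ u≢L) = trans (erase-∷-≢ u b≢L) (cong (b ∷_) (erase-insert [] u u≢L))
  erase-insert (zero ∷ c)  u       u≢L          = trans (erase-∷-≡ (insert c u)) (erase-insert c u u≢L)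
  erase-insert (suc k ∷ c) []      u≢L          = trans (erase-∷-≡ (insert c [])) (erase-insert c [] u≢L)
  erase-insert (suc k ∷ c) (b ∷ u) (b≢L ∷ u≢L) =
    trans (erase-∷-≢ (insert (k ∷ map pred c) u) b≢L) (cong (b ∷_) (erase-insert (k ∷ map pred c) u u≢L))

  positions-insert : ∀ c u → All (_≢ L) u → Linked _≤_ c → All (_≤ length u) c → positions (insert c u) ≡ c
  positions-insert []          []      []           _  _  = refl
  positions-insert []          (b ∷ u) (b≢L ∷ u≢L) _  _  =
    trans (positions-∷-≢ u b≢L) (cong (map suc) (positions-insert [] u u≢L [] []))
  positions-insert (zero ∷ c)  u       u≢L          lk (_ ∷ c≤) =
    trans (positions-∷-≡ (insert c u)) (cong (0 ∷_) (positions-insert c u u≢L (Linked.tail lk) c≤))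
  positions-insert (suc k ∷ c) (b ∷ u) (b≢L ∷ u≢L) lk (s≤s k≤ ∷ c≤) = begin
    positions (b ∷ insert (k ∷ map pred c) u)   ≡⟨ positions-∷-≢ (insert (k ∷ map pred c) u) b≢L ⟩
    map suc (positions (insert (k ∷ map pred c) u))
      ≡⟨ cong (map suc) (positions-insert (k ∷ map pred c) u u≢L
                          (Linked.map⁺ (Linked.map pred-mono-≤ lk)) (k≤ ∷ All.map⁺ (All.map pred-mono-≤ c≤))) ⟩
    suc k ∷ map suc (map pred c)                ≡⟨ cong (suc k ∷_) (map-suc-pred c≥1) ⟩
    suc k ∷ c                                   ∎
    where
    open ≡-Reasoning
    c≥1 : All (1 ≤_) c
    c≥1 = All.tail (Linked⇒All ≤-trans (s≤s z≤n) lk)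

  occ-insert : ∀ c u → All (_≢ L) u → occ L (insert c u) ≡ length c
  occ-insert []          u       u≢L = trans (sym (length-positions u)) (cong length (positions-insert [] u u≢L [] []))
  occ-insert (zero ∷ c)  u       u≢L = trans (occ-∷-≡ L (insert c u)) (cong suc (occ-insert c u u≢L))
  occ-insert (suc k ∷ c) []      u≢L = trans (occ-∷-≡ L (insert c [])) (cong suc (occ-insert c [] u≢L))
  occ-insert (suc k ∷ c) (b ∷ u) (b≢L ∷ u≢L) =
    trans (occ-∷-≢ (insert (k ∷ map pred c) u) (≢-sym b≢L))
          (trans (occ-insert (k ∷ map pred c) u u≢L) (cong suc (length-map pred c)))

  All-insert : ∀ {P : ℕ → Set} c u → P L → All P u → All P (insert c u)
  All-insert []          u       pL pu         = pu
  All-insert (zero ∷ c)  u       pL pu         = pL ∷ All-insert c u pL pu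
  All-insert (suc k ∷ c) []      pL pu         = pL ∷ All-insert c [] pL pu
  All-insert (suc k ∷ c) (b ∷ u) pL (pb ∷ pu) = pb ∷ All-insert (k ∷ map pred c) u pL pu

  smaller-insert : ∀ {b} c u → L < b → smaller b (insert c u) ≡ length c + smaller b u
  smaller-insert []          u       L<b = refl
  smaller-insert (zero ∷ c)  u       L<b =
    trans (smaller-∷-< (insert c u) L<b) (cong suc (smaller-insert c u L<b))
  smaller-insert (suc k ∷ c) []      L<b =
    trans (smaller-∷-< (insert c []) L<b) (cong suc (smaller-insert c [] L<b))
  smaller-insert {b} (suc k ∷ c) (a ∷ u) L<b = begin
    smaller b (a ∷ insert (k ∷ map pred c) u)
      ≡⟨ smaller-∷ b a _ ⟩
    smaller b (a ∷ []) + smaller b (insert (k ∷ map pred c) u)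
      ≡⟨ cong (smaller b (a ∷ []) +_) (smaller-insert (k ∷ map pred c) u L<b) ⟩
    smaller b (a ∷ []) + (suc (length (map pred c)) + smaller b u)
      ≡⟨ cong (λ n → smaller b (a ∷ []) + (suc n + smaller b u)) (length-map pred c) ⟩
    smaller b (a ∷ []) + (suc (length c) + smaller b u)
      ≡⟨ ℕ+.x∙yz≈y∙xz (smaller b (a ∷ [])) (suc (length c)) _ ⟩
    suc (length c) + (smaller b (a ∷ []) + smaller b u)
      ≡⟨ cong (suc (length c) +_) (smaller-∷ b a u) ⟨
    suc (length c) + smaller b (a ∷ u)
      ∎
    where open ≡-Reasoning

  -- The copy of L preceded by k letters of u, all larger than L, is in exactly k inversions.
  inversions-insert : ∀ c u → All (L <_) u → Linked _≤_ c → All (_≤ length u) c →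
                      inversions (insert c u) ≡ sum c + inversions u
  inversions-insert []          u       L<u lk c≤ = refl
  inversions-insert (zero ∷ c)  u       L<u lk (_ ∷ c≤) =
    cong₂ _+_ (smaller-≥ (insert c u) (All-insert c u ≤-refl (All.map <⇒≤ L<u)))
              (inversions-insert c u L<u (Linked.tail lk) c≤)
  inversions-insert (suc k ∷ c) (b ∷ u) (L<b ∷ L<u) lk (s≤s k≤ ∷ c≤) = begin
    smaller b X + inversions X
      ≡⟨ cong₂ _+_ (smaller-insert (k ∷ map pred c) u L<b)
                   (inversions-insert (k ∷ map pred c) u L<u (Linked.map⁺ (Linked.map pred-mono-≤ lk))
                                      (k≤ ∷ All.map⁺ (All.map pred-mono-≤ c≤))) ⟩
    (suc (length (map pred c)) + smaller b u) + ((k + sum (map pred c)) + inversions u)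
      ≡⟨ rearrange (length (map pred c)) (smaller b u) k (sum (map pred c)) (inversions u) ⟩
    (suc k + (length (map pred c) + sum (map pred c))) + (smaller b u + inversions u)
      ≡⟨ cong (λ n → (suc k + n) + (smaller b u + inversions u)) (sum-map-suc (map pred c)) ⟨
    (suc k + sum (map suc (map pred c))) + (smaller b u + inversions u)
      ≡⟨ cong (λ c′ → (suc k + sum c′) + (smaller b u + inversions u)) (map-suc-pred c≥1) ⟩
    (suc k + sum c) + (smaller b u + inversions u)
      ∎
    where
    open ≡-Reasoning
    X : List ℕ
    X = insert (k ∷ map pred c) u
    c≥1 : All (1 ≤_) c
    c≥1 = All.tail (Linked⇒All ≤-trans (s≤s z≤n) lk)
    rearrange : ∀ l s k p i → (suc l + s) + ((k + p) + i) ≡ (suc k + (l + p)) + (s + i)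
    rearrange = solve-∀

-- BL(m)

-- o ⊕ x = o + x, recursing on o: the letters (suc o) ⊕ suc i of BLFrom (suc o) ms are
-- then definitionally the letters o ⊕ suc (suc i) of BLFrom o (mi ∷ ms) after the first.
_⊕_ : ℕ → ℕ → ℕ
zero  ⊕ x = x
suc o ⊕ x = o ⊕ suc x

⊕≡+ : ∀ o x → o ⊕ x ≡ o + x
⊕≡+ zero    x = refl
⊕≡+ (suc o) x = trans (⊕≡+ o (suc x)) (+-suc o x)

⊕-suc : ∀ o x → o ⊕ suc x ≡ suc (o ⊕ x)
⊕-suc o x = trans (⊕≡+ o (suc x)) (trans (+-suc o x) (cong suc (sym (⊕≡+ o x))))

⊕-monoʳ-< : ∀ o {x y} → x < y → o ⊕ x < o ⊕ y
⊕-monoʳ-< o {x} {y} x<y = subst₂ _<_ (sym (⊕≡+ o x)) (sym (⊕≡+ o y)) (+-monoʳ-< o x<y)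

-- IsBLFrom 0 m is IsBL m; for larger o every letter is raised by o.
IsBLFrom : ℕ → List ℕ → List ℕ → Set
IsBLFrom o m w =
  All (λ a → o ⊕ 1 ≤ a × a ≤ o ⊕ length m) w
  × All (λ p → occ (proj₁ p) w ≡ proj₂ p) (zip (applyUpTo (λ i → o ⊕ suc i) (length m)) m)
  × All (λ i → firstPos i w < firstPos (suc i) w) (applyUpTo (λ i → o ⊕ suc i) (length m ∸ 1))

BLFrom : ℕ → List ℕ → Set
BLFrom o m = Σ (List ℕ) (IsBLFrom o m)

IsBLFrom-irrelevant : ∀ {o m} → U.Irrelevant (IsBLFrom o m)
IsBLFrom-irrelevant (ls , os , fs) (ls′ , os′ , fs′) =
  cong₂ _,_ (All.irrelevant (λ (p , q) (p′ , q′) → cong₂ _,_ (≤-irrelevant p p′) (≤-irrelevant q q′)) ls ls′)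
    (cong₂ _,_ (All.irrelevant ≡-irrelevant os os′) (All.irrelevant <-irrelevant fs fs′))

All-occ-cong : ∀ f ms w w′ → (∀ i → occ (f i) w ≡ occ (f i) w′) →
               All (λ p → occ (proj₁ p) w ≡ proj₂ p) (zip (applyUpTo f (length ms)) ms) →
               All (λ p → occ (proj₁ p) w′ ≡ proj₂ p) (zip (applyUpTo f (length ms)) ms)
All-occ-cong f []       w w′ eq []       = []
All-occ-cong f (m ∷ ms) w w′ eq (p ∷ ps) =
  trans (sym (eq 0)) p ∷ All-occ-cong (λ i → f (suc i)) ms w w′ (λ i → eq (suc i)) ps

All-applyUpTo-map : ∀ {P Q : ℕ → Set} f n → (∀ i → P (f i) → Q (f i)) →
                    All P (applyUpTo f n) → All Q (applyUpTo f n)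
All-applyUpTo-map f n g ps = All.applyUpTo⁺₁ f n (λ i<n → g _ (All.applyUpTo⁻ f n ps i<n))

letter-index : ∀ o n {b} → o ⊕ 1 ≤ b → b < o ⊕ suc n → Σ ℕ λ i → i < n × o ⊕ suc i ≡ b
letter-index o zero    first≤b b<first = contradiction (≤-<-trans first≤b b<first) (<-irrefl refl)
letter-index o (suc n) {b} first≤b b<last with b ≟ o ⊕ 1
... | yes b≡first = 0 , z<s , sym b≡first
... | no  b≢first with letter-index (suc o) n second≤b b<last
  where
  second≤b : suc o ⊕ 1 ≤ b
  second≤b = subst (_≤ b) (sym (⊕-suc o 1)) (≤∧≢⇒< first≤b (≢-sym b≢first))
...   | i , i<n , e = suc i , s<s i<n , e

BLFrom-[] : ∀ o {w} → IsBLFrom o [] w → w ≡ []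
BLFrom-[] o {[]}    _                        = refl
BLFrom-[] o {a ∷ w} ((first≤a , a≤last) ∷ _ , _) =
  contradiction (subst (_≤ o ⊕ 0) (⊕-suc o 0) (≤-trans first≤a a≤last)) (<-irrefl refl)

module _ (o : ℕ) where

  first<letter : ∀ i → o ⊕ 1 < suc o ⊕ suc i
  first<letter i = ⊕-monoʳ-< o (s<s z<s)

  letter≢first : ∀ i → suc o ⊕ suc i ≢ o ⊕ 1
  letter≢first i = >⇒≢ (first<letter i)

  suc-letter≢first : ∀ i → suc (suc o ⊕ suc i) ≢ o ⊕ 1
  suc-letter≢first i = >⇒≢ (m<n⇒m<1+n (first<letter i))

  BLFrom-∷-starts : ∀ {mi ms w} → 1 ≤ mi → IsBLFrom o (mi ∷ ms) w → Σ (List ℕ) λ w′ → w ≡ o ⊕ 1 ∷ w′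
  BLFrom-∷-starts {ms = ms} {[]}    mi≥1 (_ , occ-first ∷ _ , _) = contradiction (sym occ-first) (>⇒≢ mi≥1)
  BLFrom-∷-starts {ms = ms} {a ∷ w} mi≥1 ((first≤a , a≤last) ∷ _ , _ , fs) with a ≟ o ⊕ 1
  ... | yes refl = w , refl
  ... | no  a≢first  with a | ≤∧≢⇒< first≤a (≢-sym a≢first)
  ...   | suc b | s≤s first≤b with letter-index o (length ms) first≤b a≤last
  ...     | i , i<n , refl =
    contradiction (subst (firstPos b (suc b ∷ w) <_) (firstPos-∷-≡ (suc b) w)
                         (All.applyUpTo⁻ _ (length ms) fs i<n))
                  n≮0

  erase-BLFrom : ∀ {mi ms w} → IsBLFrom o (mi ∷ ms) w → IsBLFrom (suc o) ms (erase (o ⊕ 1) w)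
  erase-BLFrom {ms = ms} {w} (ls , _ ∷ os , fs) =
    All-erase (o ⊕ 1) w (All.map (λ (first≤a , a≤last) a≢first → second≤ first≤a a≢first , a≤last) ls) ,
    All-occ-cong _ ms w (erase (o ⊕ 1) w) (λ i → sym (occ-erase (o ⊕ 1) w (letter≢first i))) os ,
    erase-firstPos ms fs
    where
    second≤ : ∀ {a} → o ⊕ 1 ≤ a → a ≢ o ⊕ 1 → suc o ⊕ 1 ≤ a
    second≤ first≤a a≢first = subst (_≤ _) (sym (⊕-suc o 1)) (≤∧≢⇒< first≤a (≢-sym a≢first))
    erase-firstPos : ∀ ms → All (λ i → firstPos i w < firstPos (suc i) w)
                                (applyUpTo (λ i → o ⊕ suc i) (length ms)) →
                     All (λ i → firstPos i (erase (o ⊕ 1) w) < firstPos (suc i) (erase (o ⊕ 1) w))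
                         (applyUpTo (λ i → suc o ⊕ suc i) (length ms ∸ 1))
    erase-firstPos []       _        = []
    erase-firstPos (_ ∷ ms) (_ ∷ fs) = All-applyUpTo-map _ (length ms)
      (λ i → Equivalence.to (firstPos<-erase (o ⊕ 1) w (letter≢first i) (suc-letter≢first i)))
      fs

length-BLFrom : ∀ o m {w} → IsBLFrom o m w → length w ≡ sum m
length-BLFrom o []        p = cong length (BLFrom-[] o p)
length-BLFrom o (mi ∷ ms) {w} p@(_ , occ-first ∷ _ , _) =
  trans (length-erase (o ⊕ 1) w) (cong₂ _+_ occ-first (length-BLFrom (suc o) ms (erase-BLFrom o p)))

module _ (o : ℕ) where

  positions-Block : ∀ {mi ms w} → 1 ≤ mi → IsBLFrom o (mi ∷ ms) w → Block mi (sum ms) (positions (o ⊕ 1) w)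
  positions-Block {ms = ms} {w} mi≥1 p@(_ , occ-first ∷ _ , _) =
    trans (length-positions (o ⊕ 1) w) occ-first ,
    starts-with-0 (BLFrom-∷-starts o mi≥1 p) ,
    positions-linked (o ⊕ 1) w ,
    subst (λ n → All (_≤ n) (positions (o ⊕ 1) w)) (length-BLFrom (suc o) ms (erase-BLFrom o p))
          (positions-≤ (o ⊕ 1) w)
    where
    starts-with-0 : Σ (List ℕ) (λ w′ → w ≡ o ⊕ 1 ∷ w′) → head (positions (o ⊕ 1) w) ≡ just 0
    starts-with-0 (w′ , refl) = cong head (positions-∷-≡ (o ⊕ 1) w′)

  above-first : ∀ {ms u} → IsBLFrom (suc o) ms u → All (o ⊕ 1 <_) u
  above-first (ls , _) = All.map (λ (first≤a , _) → subst (_≤ _) (⊕-suc o 1) first≤a) ls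

  insert-BLFrom : ∀ {mi ms x u} → Block mi (sum ms) x → IsBLFrom (suc o) ms u →
                  IsBLFrom o (mi ∷ ms) (insert (o ⊕ 1) x u)
  insert-BLFrom {mi} {ms} {0 ∷ x} {u} (l , refl , _ , _) pu@(ls , os , fs) =
    All-insert (o ⊕ 1) (0 ∷ x) u (≤-refl , first≤last)
      (All.zipWith (λ (first<a , (_ , a≤last)) → <⇒≤ first<a , a≤last) (above-first pu , ls)) ,
    trans (occ-insert (o ⊕ 1) (0 ∷ x) u u≢first) l ∷
      All-occ-cong _ ms u w (λ i → trans (cong (occ _) (sym (erase-insert (o ⊕ 1) (0 ∷ x) u u≢first)))
                                         (occ-erase (o ⊕ 1) w (letter≢first o i))) os ,
    insert-firstPos ms fs
    where
    w : List ℕ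
    w = insert (o ⊕ 1) (0 ∷ x) u
    first≤last : o ⊕ 1 ≤ o ⊕ suc (length ms)
    first≤last = subst₂ _≤_ (sym (⊕≡+ o 1)) (sym (⊕≡+ o (suc (length ms)))) (+-monoʳ-≤ o (s≤s z≤n))
    u≢first : All (_≢ o ⊕ 1) u
    u≢first = All.map >⇒≢ (above-first pu)
    insert-firstPos : ∀ ms → All (λ i → firstPos i u < firstPos (suc i) u)
                                 (applyUpTo (λ i → suc o ⊕ suc i) (length ms ∸ 1)) →
                      All (λ i → firstPos i w < firstPos (suc i) w) (applyUpTo (λ i → o ⊕ suc i) (length ms))
    insert-firstPos []       _  = []
    insert-firstPos (_ ∷ ms) fs =
      subst₂ _<_ (sym (firstPos-∷-≡ (o ⊕ 1) (insert (o ⊕ 1) x u)))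
                 (sym (firstPos-∷-≢ (insert (o ⊕ 1) x u) (>⇒≢ (n<1+n (o ⊕ 1)))))
                 z<s ∷
      All-applyUpTo-map _ (length ms)
        (λ i h → Equivalence.from (firstPos<-erase (o ⊕ 1) w (letter≢first o i) (suc-letter≢first o i))
                   (subst (λ v → firstPos _ v < firstPos _ v) (sym (erase-insert (o ⊕ 1) (0 ∷ x) u u≢first)) h))
        fs

  -- A word is determined by where its first letter sits among the other letters, and by those.
  BLFrom-∷↔ : ∀ {mi ms} → 1 ≤ mi → BLFrom o (mi ∷ ms) ↔ (Σ (List ℕ) (Block mi (sum ms)) × BLFrom (suc o) ms)
  BLFrom-∷↔ {mi} {ms} mi≥1 = mk↔ₛ′ to from to∘from from∘to
    where
    to : BLFrom o (mi ∷ ms) → Σ (List ℕ) (Block mi (sum ms)) × BLFrom (suc o) ms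
    to (w , p) = (positions (o ⊕ 1) w , positions-Block {ms = ms} {w} mi≥1 p) ,
                 (erase (o ⊕ 1) w , erase-BLFrom o p)
    from : Σ (List ℕ) (Block mi (sum ms)) × BLFrom (suc o) ms → BLFrom o (mi ∷ ms)
    from ((x , b) , (u , p)) = insert (o ⊕ 1) x u , insert-BLFrom {mi} {ms} {x} {u} b p
    to∘from : ∀ y → to (from y) ≡ y
    to∘from ((x , b@(_ , _ , lk , x≤)) , (u , p)) = cong₂ _,_
      (Σ-≡-irrelevant (Block-irrelevant {mi} {sum ms})
        (positions-insert (o ⊕ 1) x u u≢first lk
          (subst (λ n → All (_≤ n) x) (sym (length-BLFrom (suc o) ms p)) x≤)))
      (Σ-≡-irrelevant (IsBLFrom-irrelevant {suc o} {ms}) (erase-insert (o ⊕ 1) x u u≢first))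
      where
      u≢first : All (_≢ o ⊕ 1) u
      u≢first = All.map >⇒≢ (above-first {ms} {u} p)
    from∘to : ∀ w → from (to w) ≡ w
    from∘to (w , _) = Σ-≡-irrelevant (IsBLFrom-irrelevant {o} {mi ∷ ms}) (insert-positions-erase (o ⊕ 1) w)

V↔BLFrom : ∀ o m → All (1 ≤_) m → V m ↔ BLFrom o m
V↔BLFrom o []        _           =
  mk↔ₛ′ (λ _ → [] , [] , [] , []) (λ _ → [] , [])
        (λ (w , p) → Σ-≡-irrelevant (IsBLFrom-irrelevant {o} {[]}) (sym (BLFrom-[] o p)))
        (λ { ([] , []) → refl })
V↔BLFrom o (mi ∷ ms) (mi≥1 ∷ h) =
  ↔-sym (BLFrom-∷↔ o mi≥1) ↔-∘ ((↔-refl ×-↔ V↔BLFrom (suc o) ms h) ↔-∘ V-∷↔ mi ms)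

inversions-V↔BLFrom : ∀ o m (h : All (1 ≤_) m) v → inversions (proj₁ (Inverse.to (V↔BLFrom o m h) v)) ≡ rankV v
inversions-V↔BLFrom o []        _           ([] , [])                          = refl
inversions-V↔BLFrom o (mi ∷ ms) (mi≥1 ∷ h) (x ∷ xs , (_ , _ , lk , x≤) ∷ v) =
  trans (inversions-insert (o ⊕ 1) x u (above-first o {ms} {u} p) lk
           (subst (λ n → All (_≤ n) x) (sym (length-BLFrom (suc o) ms p)) x≤))
        (cong (sum x +_) (inversions-V↔BLFrom (suc o) ms h (xs , v)))
  where
  u : List ℕ
  u = proj₁ (Inverse.to (V↔BLFrom (suc o) ms h) (xs , v))
  p : IsBLFrom (suc o) ms u
  p = proj₂ (Inverse.to (V↔BLFrom (suc o) ms h) (xs , v))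

IsRankGenFun-BL : ∀ m → All (1 ≤_) m → IsRankGenFun (BL m) rankBL (gaussProduct m)
IsRankGenFun-BL m h =
  IsRankGenFun-↔ {F = gaussProduct m} (V↔BLFrom 0 m h) (inversions-V↔BLFrom 0 m h) (IsRankGenFun-V m h)

gaussProduct-*P-qBinomDen : ∀ m → All (1 ≤_) m →
  gaussProduct m *P prodP (map qBinomDen (binomParams m)) ≈ prodP (map qBinomNum (binomParams m))
gaussProduct-*P-qBinomDen []           _       = *P-identityˡ (1 ∷ [])
gaussProduct-*P-qBinomDen (suc r ∷ ms) (_ ∷ h) = begin
  (gauss r (sum ms) *P gaussProduct ms) *P ((qFact (r + sum ms ∸ r) *P qFact r) *P Den)
    ≈⟨ *P.interchange (gauss r (sum ms)) (gaussProduct ms) _ Den ⟩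
  (gauss r (sum ms) *P (qFact (r + sum ms ∸ r) *P qFact r)) *P (gaussProduct ms *P Den)
    ≡⟨ cong (λ n → (gauss r (sum ms) *P (qFact n *P qFact r)) *P (gaussProduct ms *P Den)) (m+n∸m≡n r (sum ms)) ⟩
  (gauss r (sum ms) *P (qFact (sum ms) *P qFact r)) *P (gaussProduct ms *P Den)
    ≈⟨ *P-cong (gauss-*P-qFact r (sum ms)) (gaussProduct-*P-qBinomDen ms h) ⟩
  qFact (r + sum ms) *P prodP (map qBinomNum (binomParams ms))
    ∎
  where
  open SetoidReasoning ≈-setoid
  Den : Poly
  Den = prodP (map qBinomDen (binomParams ms))

theorem4p1 : (m : List ℕ) → All (1 ≤_) m →
    Σ Poly (λ F →
      IsRankGenFun (V m) rankV F
      × IsRankGenFun (BL m) rankBL F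
      × (F *P prodP (map qBinomDen (binomParams m)) ≈P prodP (map qBinomNum (binomParams m))))
theorem4p1 m h =
  gaussProduct m , IsRankGenFun-V m h , IsRankGenFun-BL m h , coeff-≡ (gaussProduct-*P-qBinomDen m h)
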